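{- Let $n\ge1$, $m\ge2$. Let $\operatorname{Dist}(R_n,m)$ be the polytope of tuples $p=(p_{\sigma_1},\dots,p_{\sigma_n})$ of $m\times m$ nonnegative matrices with total sum $1$ such that there is a single vector in $\mathbb{R}^m$ equal to both the row-sum vector and the column-sum vector of every $p_{\sigma_k}$. Then $p\mapsto(A_1,\dots,A_n)$ with $A_k=\{(e_a,e_b)^T: p_{\sigma_k}^{ab}\neq0\}$ is a one-to-one correspondence between the vertices of $\operatorname{Dist}(R_n,m)$ and the collections $A_1,\dots,A_n$ of sets of product-simplex vertices in $\mathbb{R}^{2m}$ such that: (1) each $A_k$ is affinely independent; (2) the set $$\bigcap_{k=1}^n\operatorname{Conv}(A_k)\ \cap\ \Big\{(\alpha_1,\dots,\alpha_m,\alpha_1,\dots,\alpha_m)^T:\ \textstyle\sum_{i=1}^m\alpha_i=1\Big\}$$ consists of a single point, and for this point the coefficient of every $x\in A_k$ in its affine representation in terms of $A_k$ is nonzero, for every $k$.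
   Context: $R_n$ is the rose graph: one node and $n$ loop edges $\sigma_1,\dots,\sigma_n$. A distribution on it with outcomes $\{0,\dots,m-1\}$ assigns to each loop a probability matrix $p_{\sigma_k}=(p_{\sigma_k}^{ab})$ whose row sums and column sums both equal the common probability vector at the node; this gives the polytope $\operatorname{Dist}(R_n,m)$. $e_0,\dots,e_{m-1}$ are the standard basis vectors of $\mathbb{R}^m$; a product-simplex vertex in $\mathbb{R}^{2m}$ is a vector $(e_a,e_b)^T$ obtained by stacking $e_a$ over $e_b$. $\operatorname{Conv}$ is convex hull.
   Formalization: The matrices $p_{\sigma_k}$ have entries in ℚ rather than ℝ, and the vectors of ℚ^(2m), the vectors α and all convex and affine coefficients are rational. -}

module Defs where

open import Data.Nat using (ℕ; zero; suc; _+_)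
open import Data.Fin as Fin using (Fin; splitAt)
open import Data.Bool using (Bool; true; false; if_then_else_; not)
open import Data.Sum using (_⊎_; inj₁; inj₂)
open import Data.Product using (Σ; _×_; _,_; ∃-syntax)
open import Data.Rational as ℚ using (ℚ; 0ℚ; 1ℚ; _≤_; _<_; _-_)
open import Relation.Nullary using (¬_)
open import Relation.Nullary.Decidable using (⌊_⌋)
open import Relation.Binary.PropositionalEquality using (_≡_; _≢_)

-- Real coordinates are taken in ℚ.

∑ : ∀ {k} → (Fin k → ℚ) → ℚ
∑ {zero}  f = 0ℚ
∑ {suc k} f = f Fin.zero ℚ.+ ∑ (λ i → f (Fin.suc i))

∑₂ : ∀ {m} → (Fin m → Fin m → ℚ) → ℚ
∑₂ f = ∑ (λ a → ∑ (λ b → f a b))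

-- p k a b = p_{σ_{k+1}}^{ab}
Tuple : ℕ → ℕ → Set
Tuple n m = Fin n → Fin m → Fin m → ℚ

_≐_ : ∀ {n m} → Tuple n m → Tuple n m → Set
p ≐ q = ∀ k a b → p k a b ≡ q k a b

rowSum : ∀ {m} → (Fin m → Fin m → ℚ) → Fin m → ℚ
rowSum M a = ∑ (λ b → M a b)

colSum : ∀ {m} → (Fin m → Fin m → ℚ) → Fin m → ℚ
colSum M b = ∑ (λ a → M a b)

InDist : ∀ {n m} → Tuple n m → Set
InDist {n} {m} p =
  (∀ k a b → 0ℚ ≤ p k a b)
  × (∀ k → ∑₂ (p k) ≡ 1ℚ)
  × (Σ (Fin m → ℚ) λ v → (∀ k a → rowSum (p k) a ≡ v a × colSum (p k) a ≡ v a))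

IsVertex : ∀ {n m} → Tuple n m → Set
IsVertex {n} {m} p =
  InDist p ×
  (∀ (q r : Tuple n m) (t : ℚ) → InDist q → InDist r → 0ℚ < t → t < 1ℚ →
     (∀ k a b → p k a b ≡ t ℚ.* q k a b ℚ.+ (1ℚ - t) ℚ.* r k a b) →
     q ≐ r)

Vec2 : ℕ → Set
Vec2 m = Fin (m + m) → ℚ

δ : ∀ {m} → Fin m → Fin m → ℚ
δ a j = if ⌊ a Fin.≟ j ⌋ then 1ℚ else 0ℚ

stack : ∀ {m} → (Fin m → ℚ) → (Fin m → ℚ) → Vec2 m
stack {m} u w i with splitAt m i
... | inj₁ j = u j
... | inj₂ j = w j

psv : ∀ {m} → Fin m → Fin m → Vec2 m
psv a b = stack (δ a) (δ b)

-- A set of product-simplex vertices, indexed by the pair (a,b)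
-- (the map (a,b) ↦ (e_a,e_b)^T is injective)
PSVSet : ℕ → Set
PSVSet m = Fin m → Fin m → Bool

SupportedOn : ∀ {m} → PSVSet m → (Fin m → Fin m → ℚ) → Set
SupportedOn A c = ∀ a b → A a b ≡ false → c a b ≡ 0ℚ

comb : ∀ {m} → (Fin m → Fin m → ℚ) → Vec2 m
comb c i = ∑₂ (λ a b → c a b ℚ.* psv a b i)

AffinelyIndependent : ∀ {m} → PSVSet m → Set
AffinelyIndependent {m} A =
  ∀ (c : Fin m → Fin m → ℚ) → SupportedOn A c →
    ∑₂ c ≡ 0ℚ → (∀ i → comb c i ≡ 0ℚ) → ∀ a b → c a b ≡ 0ℚ

InConv : ∀ {m} → PSVSet m → Vec2 m → Set
InConv {m} A x =
  ∃[ c ] (SupportedOn A c × (∀ a b → 0ℚ ≤ c a b) × ∑₂ c ≡ 1ℚ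
          × (∀ i → x i ≡ comb c i))

AffineRep : ∀ {m} → PSVSet m → Vec2 m → (Fin m → Fin m → ℚ) → Set
AffineRep {m} A x c = SupportedOn A c × ∑₂ c ≡ 1ℚ × (∀ i → x i ≡ comb c i)

InDiag : ∀ {m} → Vec2 m → Set
InDiag {m} x = ∃[ α ] (∑ {m} α ≡ 1ℚ × (∀ i → x i ≡ stack {m} α α i))

Collection : ℕ → ℕ → Set
Collection n m = Fin n → PSVSet m

_≗C_ : ∀ {n m} → Collection n m → Collection n m → Set
A ≗C B = ∀ k a b → A k a b ≡ B k a b

InIntersection : ∀ {n m} → Collection n m → Vec2 m → Set
InIntersection {n} {m} A x = (∀ k → InConv {m} (A k) x) × InDiag {m} x

Good : ∀ {n m} → Collection n m → Set
Good {n} {m} A =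
  (∀ k → AffinelyIndependent (A k)) ×
  (∃[ x ] (InIntersection {n} {m} A x
           × (∀ (y : Vec2 m) → InIntersection A y → ∀ i → y i ≡ x i)
           × (∀ k c → AffineRep {m} (A k) x c →
                ∀ a b → A k a b ≡ true → c a b ≢ 0ℚ)))

Φ : ∀ {n m} → Tuple n m → Collection n m
Φ p k a b = not ⌊ p k a b ℚ.≟ 0ℚ ⌋

{-# OPTIONS --safe #-}
-- Dist(R_n, m) is cut out of the nonnegative orthant by linear equations, so p ∈ Dist(R_n, m)
-- is a vertex iff no nonzero solution d of the homogeneous equations is supported inside supp p
-- (otherwise p is the midpoint of p ± εd), i.e. iff p is the only point of Dist(R_n, m) whose
-- support lies in supp p.  The two halves of Σ c_ab (e_a, e_b)ᵀ are the row and column sums of c,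
-- so a tuple of matrices with supports in A_1, …, A_n lies in Dist(R_n, m) exactly when its k-th
-- matrix is a convex representation, in terms of A_k, of one common point (α, α)ᵀ.  Through this
-- dictionary, rigidity of the support of a vertex p says that for A_k = supp p_k the intersection
-- is one point whose representations are unique (affine independence), hence are the p_k and have
-- no zero coefficient; conversely these conditions on A make its tuple of representations rigid.
module Submission where

open import Defs
open import Data.Bool using (true; false)
open import Data.Empty using (⊥-elim)
open import Data.Fin as Fin using (Fin; zero; suc; splitAt; _↑ˡ_; _↑ʳ_)
open import Data.Fin.Properties using (splitAt-↑ˡ; splitAt-↑ʳ)
import Data.Nat as ℕ
open import Data.Nat using (ℕ; _≤_)
open import Data.Product using (_×_; _,_; proj₁; proj₂; ∃-syntax)
import Data.Rational as ℚ
open import Data.Rational using (ℚ; 0ℚ; 1ℚ; ½; _+_; _*_; _-_; -_; 1/_)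
open import Data.Rational.Properties
open import Data.Sum using (inj₁; inj₂)
open import Function using (_∘_)
open import Function.Bundles using (_⇔_; mk⇔; Equivalence)
open import Level using (0ℓ)
open import Relation.Binary.PropositionalEquality
open import Relation.Nullary using (yes; no)
open import Relation.Nullary.Decidable using (dec⇒maybe; from-yes)
open import Tactic.RingSolver using (solve-∀)
open import Tactic.RingSolver.Core.AlmostCommutativeRing using (AlmostCommutativeRing; fromCommutativeRing)

open Equivalence using (to; from)
open ≡-Reasoning

ℚ-ring : AlmostCommutativeRing 0ℓ 0ℓ
ℚ-ring = fromCommutativeRing +-*-commutativeRing (λ x → dec⇒maybe (0ℚ ≟ x))

difference≡0⇒≡ : ∀ {x y} → x + (- 1ℚ) * y ≡ 0ℚ → x ≡ y
difference≡0⇒≡ {x} {y} x-y≡0 = begin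
  x                        ≡⟨ split x y ⟩
  (x + (- 1ℚ) * y) + y     ≡⟨ cong (_+ y) x-y≡0 ⟩
  0ℚ + y                   ≡⟨ +-identityˡ y ⟩
  y                        ∎
  where
  split : ∀ x y → x ≡ (x + (- 1ℚ) * y) + y
  split = solve-∀ ℚ-ring

difference-self : ∀ x → x + (- 1ℚ) * x ≡ 0ℚ
difference-self = solve-∀ ℚ-ring

0≤* : ∀ {x y} → 0ℚ ℚ.≤ x → 0ℚ ℚ.≤ y → 0ℚ ℚ.≤ x * y
0≤* {x} {y} x≥0 y≥0 = nonNegative⁻¹ (x * y)
  {{nonNeg*nonNeg⇒nonNeg x {{ℚ.nonNegative x≥0}} y {{ℚ.nonNegative y≥0}}}}

pos*x≡0⇒x≡0 : ∀ {z x} → 0ℚ ℚ.< z → z * x ≡ 0ℚ → x ≡ 0ℚ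
pos*x≡0⇒x≡0 {z} {x} z>0 zx≡0 = begin
  x                   ≡⟨ sym (*-identityˡ x) ⟩
  1ℚ * x              ≡⟨ cong (_* x) (sym (*-inverseˡ z)) ⟩
  (1/ z) * z * x      ≡⟨ *-assoc (1/ z) z x ⟩
  (1/ z) * (z * x)    ≡⟨ cong ((1/ z) *_) zx≡0 ⟩
  (1/ z) * 0ℚ         ≡⟨ *-zeroʳ (1/ z) ⟩
  0ℚ                  ∎
  where
  instance
    z≢0 : ℚ.NonZero z
    z≢0 = pos⇒nonZero z {{ℚ.positive z>0}}

nonneg+nonneg≡0⇒≡0 : ∀ {x y} → 0ℚ ℚ.≤ x → 0ℚ ℚ.≤ y → x + y ≡ 0ℚ → x ≡ 0ℚ
nonneg+nonneg≡0⇒≡0 {x} {y} x≥0 y≥0 x+y≡0 = ≤-antisym (≤-trans x≤x+y (≤-reflexive x+y≡0)) x≥0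
  where
  x≤x+y : x ℚ.≤ x + y
  x≤x+y = subst (ℚ._≤ x + y) (+-identityʳ x) (+-monoʳ-≤ x y≥0)

±-cancel : ∀ {x ε y} → 0ℚ ℚ.< ε → x + ε * y ≡ x + (- ε) * y → y ≡ 0ℚ
±-cancel {x} {ε} {y} ε>0 x+εy≡x-εy = pos*x≡0⇒x≡0 (+-mono-< ε>0 ε>0) (begin
  (ε + ε) * y                       ≡⟨ spread x ε y ⟩
  (x + ε * y) - (x + (- ε) * y)     ≡⟨ cong (λ z → z - (x + (- ε) * y)) x+εy≡x-εy ⟩
  (x + (- ε) * y) - (x + (- ε) * y) ≡⟨ +-inverseʳ (x + (- ε) * y) ⟩
  0ℚ                                ∎)
  where
  spread : ∀ x ε y → (ε + ε) * y ≡ (x + ε * y) - (x + (- ε) * y)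
  spread = solve-∀ ℚ-ring

Mat : ℕ → Set
Mat m = Fin m → Fin m → ℚ

∑-cong : ∀ {k} {f g : Fin k → ℚ} → (∀ i → f i ≡ g i) → ∑ f ≡ ∑ g
∑-cong {ℕ.zero}  f≗g = refl
∑-cong {ℕ.suc k} f≗g = cong₂ _+_ (f≗g zero) (∑-cong (f≗g ∘ suc))

∑-0 : ∀ {k} → ∑ {k} (λ _ → 0ℚ) ≡ 0ℚ
∑-0 {ℕ.zero}  = refl
∑-0 {ℕ.suc k} = cong (0ℚ +_) (∑-0 {k})

∑-+* : ∀ {k} (f g : Fin k → ℚ) s → ∑ (λ i → f i + s * g i) ≡ ∑ f + s * ∑ g
∑-+* {ℕ.zero}  f g s = sym (cong (0ℚ +_) (*-zeroʳ s))
∑-+* {ℕ.suc k} f g s = begin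
  (f zero + s * g zero) + ∑ (λ i → f (suc i) + s * g (suc i))
    ≡⟨ cong (f zero + s * g zero +_) (∑-+* (f ∘ suc) (g ∘ suc) s) ⟩
  (f zero + s * g zero) + (∑ (f ∘ suc) + s * ∑ (g ∘ suc))
    ≡⟨ interchange (f zero) (g zero) (∑ (f ∘ suc)) (∑ (g ∘ suc)) s ⟩
  (f zero + ∑ (f ∘ suc)) + s * (g zero + ∑ (g ∘ suc)) ∎
  where
  interchange : ∀ a b c d s → (a + s * b) + (c + s * d) ≡ (a + c) + s * (b + d)
  interchange = solve-∀ ℚ-ring

∑-*ʳ : ∀ {k} (f : Fin k → ℚ) s → ∑ (λ i → f i * s) ≡ ∑ f * s
∑-*ʳ {ℕ.zero}  f s = sym (*-zeroˡ s)
∑-*ʳ {ℕ.suc k} f s =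
  trans (cong (f zero * s +_) (∑-*ʳ (f ∘ suc) s)) (sym (*-distribʳ-+ s (f zero) (∑ (f ∘ suc))))

δ-suc : ∀ {k} (a j : Fin k) → δ (suc a) (suc j) ≡ δ a j
δ-suc a j with a Fin.≟ j
... | yes _ = refl
... | no _  = refl

∑-δ : ∀ {k} (g : Fin k → ℚ) j → ∑ (λ a → g a * δ a j) ≡ g j
∑-δ {ℕ.suc k} g zero = begin
  g zero * 1ℚ + ∑ (λ a → g (suc a) * 0ℚ)
    ≡⟨ cong₂ _+_ (*-identityʳ (g zero)) (∑-cong (*-zeroʳ ∘ g ∘ suc)) ⟩
  g zero + ∑ {k} (λ _ → 0ℚ)   ≡⟨ cong (g zero +_) (∑-0 {k}) ⟩
  g zero + 0ℚ                 ≡⟨ +-identityʳ (g zero) ⟩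
  g zero                      ∎
∑-δ {ℕ.suc k} g (suc j) = begin
  g zero * 0ℚ + ∑ (λ a → g (suc a) * δ (suc a) (suc j))
    ≡⟨ cong₂ _+_ (*-zeroʳ (g zero)) (∑-cong (λ a → cong (g (suc a) *_) (δ-suc a j))) ⟩
  0ℚ + ∑ (λ a → g (suc a) * δ a j)
    ≡⟨ cong (0ℚ +_) (∑-δ (g ∘ suc) j) ⟩
  0ℚ + g (suc j)              ≡⟨ +-identityˡ (g (suc j)) ⟩
  g (suc j)                   ∎

∑₂-cong : ∀ {m} {c d : Mat m} → (∀ a b → c a b ≡ d a b) → ∑₂ c ≡ ∑₂ d
∑₂-cong c≗d = ∑-cong (∑-cong ∘ c≗d)

∑₂-0 : ∀ {m} → ∑₂ {m} (λ _ _ → 0ℚ) ≡ 0ℚ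
∑₂-0 {m} = trans (∑-cong {m} (λ _ → ∑-0 {m})) (∑-0 {m})

_+[_]_ : ∀ {m} → Mat m → ℚ → Mat m → Mat m
(c +[ s ] d) a b = c a b + s * d a b

∑₂-+[] : ∀ {m} (c d : Mat m) s → ∑₂ (c +[ s ] d) ≡ ∑₂ c + s * ∑₂ d
∑₂-+[] c d s = trans (∑-cong (λ a → ∑-+* (c a) (d a) s)) (∑-+* (∑ ∘ c) (∑ ∘ d) s)

stack-↑ˡ : ∀ {m} (u w : Fin m → ℚ) j → stack u w (j ↑ˡ m) ≡ u j
stack-↑ˡ {m} u w j rewrite splitAt-↑ˡ m j m = refl

stack-↑ʳ : ∀ {m} (u w : Fin m → ℚ) j → stack u w (m ↑ʳ j) ≡ w j
stack-↑ʳ {m} u w j rewrite splitAt-↑ʳ m m j = refl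

stack-const : ∀ {m} z (i : Fin (m ℕ.+ m)) → stack {m} (λ _ → z) (λ _ → z) i ≡ z
stack-const {m} z i with splitAt m i
... | inj₁ _ = refl
... | inj₂ _ = refl

stack-cong : ∀ {m} {u u′ w w′ : Fin m → ℚ} → (∀ j → u j ≡ u′ j) → (∀ j → w j ≡ w′ j) →
             ∀ i → stack u w i ≡ stack u′ w′ i
stack-cong {m} u≗u′ w≗w′ i with splitAt m i
... | inj₁ j = u≗u′ j
... | inj₂ j = w≗w′ j

comb≗stack : ∀ {m} (c : Mat m) i → comb c i ≡ stack (rowSum c) (colSum c) i
comb≗stack {m} c i with splitAt m i
... | inj₁ j = trans (∑-cong (λ a → ∑-*ʳ (c a) (δ a j))) (∑-δ (rowSum c) j)
... | inj₂ j = ∑-cong (λ a → ∑-δ (c a) j)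

HasMarginal : ∀ {m} → Mat m → (Fin m → ℚ) → Set
HasMarginal c v = ∀ a → rowSum c a ≡ v a × colSum c a ≡ v a

stack≗comb⇔HasMarginal : ∀ {m} (c : Mat m) v → (∀ i → stack v v i ≡ comb c i) ⇔ HasMarginal c v
stack≗comb⇔HasMarginal {m} c v = mk⇔ marginal stacked
  where
  marginal : (∀ i → stack v v i ≡ comb c i) → HasMarginal c v
  marginal v≗c a =
      trans (sym (stack-↑ˡ (rowSum c) (colSum c) a)) (trans (sym (v≗sums (a ↑ˡ m))) (stack-↑ˡ v v a))
    , trans (sym (stack-↑ʳ (rowSum c) (colSum c) a)) (trans (sym (v≗sums (m ↑ʳ a))) (stack-↑ʳ v v a))
    where
    v≗sums : ∀ i → stack v v i ≡ stack (rowSum c) (colSum c) i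
    v≗sums i = trans (v≗c i) (comb≗stack c i)
  stacked : HasMarginal c v → ∀ i → stack v v i ≡ comb c i
  stacked cv i = sym (trans (comb≗stack c i) (stack-cong (proj₁ ∘ cv) (proj₂ ∘ cv) i))

HasMarginal-+[] : ∀ {m} {c d : Mat m} {v w} s → HasMarginal c v → HasMarginal d w →
                  HasMarginal (c +[ s ] d) (λ a → v a + s * w a)
HasMarginal-+[] {c = c} {d} s cv dw a =
    trans (∑-+* (c a) (d a) s) (cong₂ (λ x y → x + s * y) (proj₁ (cv a)) (proj₁ (dw a)))
  , trans (∑-+* (λ b → c b a) (λ b → d b a) s) (cong₂ (λ x y → x + s * y) (proj₂ (cv a)) (proj₂ (dw a)))

comb-+[] : ∀ {m} (c d : Mat m) s i → comb (c +[ s ] d) i ≡ comb c i + s * comb d i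
comb-+[] c d s i =
  trans (∑₂-cong (λ a b → distrib (c a b) s (d a b) (psv a b i)))
        (∑₂-+[] (λ a b → c a b * psv a b i) (λ a b → d a b * psv a b i) s)
  where
  distrib : ∀ x s y z → (x + s * y) * z ≡ x * z + s * (y * z)
  distrib = solve-∀ ℚ-ring

ForSmall : (ℚ → Set) → Set
ForSmall P = ∃[ ε ] (0ℚ ℚ.< ε × ∀ δ → 0ℚ ℚ.≤ δ → δ ℚ.≤ ε → P δ)

ForSmall-map : ∀ {P Q : ℚ → Set} → (∀ {δ} → P δ → Q δ) → ForSmall P → ForSmall Q
ForSmall-map P⇒Q (ε , ε>0 , P↓) = ε , ε>0 , λ δ δ≥0 δ≤ε → P⇒Q (P↓ δ δ≥0 δ≤ε)

ForSmall-× : ∀ {P Q : ℚ → Set} → ForSmall P → ForSmall Q → ForSmall (λ δ → P δ × Q δ)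
ForSmall-× (ε₁ , ε₁>0 , P↓) (ε₂ , ε₂>0 , Q↓) with ≤-total ε₁ ε₂
... | inj₁ ε₁≤ε₂ = ε₁ , ε₁>0 , λ δ δ≥0 δ≤ε₁ → P↓ δ δ≥0 δ≤ε₁ , Q↓ δ δ≥0 (≤-trans δ≤ε₁ ε₁≤ε₂)
... | inj₂ ε₂≤ε₁ = ε₂ , ε₂>0 , λ δ δ≥0 δ≤ε₂ → P↓ δ δ≥0 (≤-trans δ≤ε₂ ε₂≤ε₁) , Q↓ δ δ≥0 δ≤ε₂

ForSmall-∀ : ∀ {k} {P : Fin k → ℚ → Set} → (∀ i → ForSmall (P i)) → ForSmall (λ δ → ∀ i → P i δ)
ForSmall-∀ {ℕ.zero}  _ = 1ℚ , positive⁻¹ 1ℚ , λ _ _ _ ()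
ForSmall-∀ {ℕ.suc k} {P} small = ForSmall-map cons (ForSmall-× (small zero) (ForSmall-∀ (small ∘ suc)))
  where
  cons : ∀ {δ} → P zero δ × (∀ i → P (suc i) δ) → ∀ i → P i δ
  cons (P₀ , _) zero    = P₀
  cons (_ , Pₛ) (suc i) = Pₛ i

ForSmall-0≤+*-neg : ∀ {x y} → 0ℚ ℚ.< x → y ℚ.< 0ℚ → ForSmall (λ δ → 0ℚ ℚ.≤ x + δ * y)
ForSmall-0≤+*-neg {x} {y} x>0 y<0 = ε , positive⁻¹ ε , λ δ _ δ≤ε →
  ≤-trans (≤-reflexive (sym x+εy≡0)) (+-monoʳ-≤ x (*-monoʳ-≤-nonPos y δ≤ε))
  where
  instance
    x-pos : ℚ.Positive x
    x-pos = ℚ.positive x>0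
    y-nonPos : ℚ.NonPositive y
    y-nonPos = ℚ.nonPositive (<⇒≤ y<0)
    -y-pos : ℚ.Positive (- y)
    -y-pos = ℚ.positive (neg-antimono-< y<0)
    -y-nonZero : ℚ.NonZero (- y)
    -y-nonZero = pos⇒nonZero (- y)
    1/-y-pos : ℚ.Positive (1/ (- y))
    1/-y-pos = 1/pos⇒pos (- y)
    ε-pos : ℚ.Positive (x * 1/ (- y))
    ε-pos = pos*pos⇒pos x (1/ (- y))
  ε : ℚ
  ε = x * 1/ (- y)
  ε*-y≡x : ε * (- y) ≡ x
  ε*-y≡x = begin
    x * 1/ (- y) * (- y)    ≡⟨ *-assoc x (1/ (- y)) (- y) ⟩
    x * (1/ (- y) * (- y))  ≡⟨ cong (x *_) (*-inverseˡ (- y)) ⟩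
    x * 1ℚ                  ≡⟨ *-identityʳ x ⟩
    x                       ∎
  x+εy≡0 : x + ε * y ≡ 0ℚ
  x+εy≡0 = begin
    x + ε * y        ≡⟨ neg-inside x ε y ⟩
    x - ε * (- y)    ≡⟨ cong (λ z → x - z) ε*-y≡x ⟩
    x - x            ≡⟨ +-inverseʳ x ⟩
    0ℚ               ∎
    where
    neg-inside : ∀ x ε y → x + ε * y ≡ x - ε * (- y)
    neg-inside = solve-∀ ℚ-ring

ForSmall-0≤+* : ∀ {x y} → 0ℚ ℚ.≤ x → (x ≡ 0ℚ → y ≡ 0ℚ) → ForSmall (λ δ → 0ℚ ℚ.≤ x + δ * y)
ForSmall-0≤+* {x} {y} x≥0 x≡0⇒y≡0 with 0ℚ ≤? y
... | yes y≥0 = 1ℚ , positive⁻¹ 1ℚ , λ δ δ≥0 _ → +-mono-≤ x≥0 (0≤* δ≥0 y≥0)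
... | no y≱0  = ForSmall-0≤+*-neg x>0 y<0
  where
  y<0 : y ℚ.< 0ℚ
  y<0 = ≰⇒> y≱0
  x>0 : 0ℚ ℚ.< x
  x>0 = ≰⇒> (λ x≤0 → <-irrefl (x≡0⇒y≡0 (≤-antisym x≤0 x≥0)) y<0)

ForSmall-0≤± : ∀ {x y} → 0ℚ ℚ.≤ x → (x ≡ 0ℚ → y ≡ 0ℚ) →
               ForSmall (λ δ → 0ℚ ℚ.≤ x + δ * y × 0ℚ ℚ.≤ x + (- δ) * y)
ForSmall-0≤± {x} {y} x≥0 x≡0⇒y≡0 =
  ForSmall-× (ForSmall-0≤+* x≥0 x≡0⇒y≡0)
             (ForSmall-map (λ {δ} → subst (λ z → 0ℚ ℚ.≤ x + z) (neg-swap δ))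
                           (ForSmall-0≤+* x≥0 (cong -_ ∘ x≡0⇒y≡0)))
  where
  neg-swap : ∀ δ → δ * (- y) ≡ (- δ) * y
  neg-swap δ = trans (sym (neg-distribʳ-* δ y)) (neg-distribˡ-* δ y)

IsDirection : ∀ {n m} → Tuple n m → Set
IsDirection d = (∀ k → ∑₂ (d k) ≡ 0ℚ) × ∃[ w ] (∀ k → HasMarginal (d k) w)

InDist-+[] : ∀ {n m} {p d : Tuple n m} {s} → InDist p → IsDirection d →
             (∀ k a b → 0ℚ ℚ.≤ (p k +[ s ] d k) a b) → InDist (λ k → p k +[ s ] d k)
InDist-+[] {p = p} {d} {s} (_ , p≡1 , v , pv) (d≡0 , w , dw) 0≤p+sd =
  0≤p+sd , total , _ , λ k → HasMarginal-+[] s (pv k) (dw k)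
  where
  total : ∀ k → ∑₂ (p k +[ s ] d k) ≡ 1ℚ
  total k = begin
    ∑₂ (p k +[ s ] d k)     ≡⟨ ∑₂-+[] (p k) (d k) s ⟩
    ∑₂ (p k) + s * ∑₂ (d k) ≡⟨ cong₂ (λ x y → x + s * y) (p≡1 k) (d≡0 k) ⟩
    1ℚ + s * 0ℚ             ≡⟨ cong (1ℚ +_) (*-zeroʳ s) ⟩
    1ℚ                      ∎

IsDirection-difference : ∀ {n m} {p q : Tuple n m} → InDist q → InDist p →
                         IsDirection (λ k → q k +[ - 1ℚ ] p k)
IsDirection-difference {p = p} {q} (_ , q≡1 , _ , qv) (_ , p≡1 , _ , pv) =
    (λ k → trans (∑₂-+[] (q k) (p k) (- 1ℚ)) (cong₂ (λ x y → x + (- 1ℚ) * y) (q≡1 k) (p≡1 k)))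
  , _ , λ k → HasMarginal-+[] (- 1ℚ) (qv k) (pv k)

_⊆ₛ_ : ∀ {n m} → Tuple n m → Tuple n m → Set
q ⊆ₛ p = ∀ k a b → p k a b ≡ 0ℚ → q k a b ≡ 0ℚ

IsVertex⇒direction≐0 : ∀ {n m} {p d : Tuple n m} → IsVertex p → IsDirection d → d ⊆ₛ p →
                       ∀ k a b → d k a b ≡ 0ℚ
IsVertex⇒direction≐0 {n} {m} {p} {d} (p∈@(p≥0 , _) , extreme) d-dir d⊆p k a b =
  ±-cancel {p k a b} ε>0 (extreme p₊ p₋ ½ p₊∈ p₋∈ (positive⁻¹ ½) (from-yes (½ <? 1ℚ)) midpoint k a b)
  where
  Fits : ℚ → Set
  Fits δ = ∀ k a b → 0ℚ ℚ.≤ (p k +[ δ ] d k) a b × 0ℚ ℚ.≤ (p k +[ - δ ] d k) a b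
  small : ForSmall Fits
  small = ForSmall-∀ λ k → ForSmall-∀ λ a → ForSmall-∀ λ b → ForSmall-0≤± (p≥0 k a b) (d⊆p k a b)
  ε : ℚ
  ε = proj₁ small
  ε>0 : 0ℚ ℚ.< ε
  ε>0 = proj₁ (proj₂ small)
  fits : Fits ε
  fits = proj₂ (proj₂ small) ε (<⇒≤ ε>0) ≤-refl
  p₊ p₋ : Tuple n m
  p₊ k = p k +[ ε ] d k
  p₋ k = p k +[ - ε ] d k
  p₊∈ : InDist p₊
  p₊∈ = InDist-+[] {s = ε} p∈ d-dir (λ k a b → proj₁ (fits k a b))
  p₋∈ : InDist p₋
  p₋∈ = InDist-+[] {s = - ε} p∈ d-dir (λ k a b → proj₂ (fits k a b))
  midpoint : ∀ k a b → p k a b ≡ ½ * p₊ k a b + (1ℚ - ½) * p₋ k a b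
  midpoint k a b = mid (p k a b) ε (d k a b)
    where
    mid : ∀ x ε y → x ≡ ½ * (x + ε * y) + (1ℚ - ½) * (x + (- ε) * y)
    mid = solve-∀ ℚ-ring

SupportRigid : ∀ {n m} → Tuple n m → Set
SupportRigid p = ∀ q → InDist q → q ⊆ₛ p → q ≐ p

IsVertex⇒SupportRigid : ∀ {n m} {p : Tuple n m} → IsVertex p → SupportRigid p
IsVertex⇒SupportRigid {p = p} vertex q q∈ q⊆p k a b =
  difference≡0⇒≡ (IsVertex⇒direction≐0 vertex (IsDirection-difference q∈ (proj₁ vertex)) q-p⊆p k a b)
  where
  q-p⊆p : (λ k → q k +[ - 1ℚ ] p k) ⊆ₛ p
  q-p⊆p k a b p≡0 = cong₂ (λ x y → x + (- 1ℚ) * y) (q⊆p k a b p≡0) p≡0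

SupportRigid⇒IsVertex : ∀ {n m} {p : Tuple n m} → InDist p → SupportRigid p → IsVertex p
SupportRigid⇒IsVertex {p = p} p∈ rigid = p∈ , extreme
  where
  extreme : ∀ q r t → InDist q → InDist r → 0ℚ ℚ.< t → t ℚ.< 1ℚ →
            (∀ k a b → p k a b ≡ t * q k a b + (1ℚ - t) * r k a b) → q ≐ r
  extreme q r t q∈@(q≥0 , _) r∈@(r≥0 , _) t>0 t<1 p≡mix k a b =
    trans (rigid q q∈ q⊆p k a b) (sym (rigid r r∈ r⊆p k a b))
    where
    1-t>0 : 0ℚ ℚ.< 1ℚ - t
    1-t>0 = subst (ℚ._< 1ℚ - t) (+-inverseʳ t) (+-monoˡ-< (- t) t<1)
    tq≥0 : ∀ k a b → 0ℚ ℚ.≤ t * q k a b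
    tq≥0 k a b = 0≤* (<⇒≤ t>0) (q≥0 k a b)
    ur≥0 : ∀ k a b → 0ℚ ℚ.≤ (1ℚ - t) * r k a b
    ur≥0 k a b = 0≤* (<⇒≤ 1-t>0) (r≥0 k a b)
    q⊆p : q ⊆ₛ p
    q⊆p k a b p≡0 =
      pos*x≡0⇒x≡0 t>0 (nonneg+nonneg≡0⇒≡0 (tq≥0 k a b) (ur≥0 k a b) (trans (sym (p≡mix k a b)) p≡0))
    r⊆p : r ⊆ₛ p
    r⊆p k a b p≡0 =
      pos*x≡0⇒x≡0 1-t>0 (nonneg+nonneg≡0⇒≡0 (ur≥0 k a b) (tq≥0 k a b)
        (trans (+-comm ((1ℚ - t) * r k a b) (t * q k a b)) (trans (sym (p≡mix k a b)) p≡0)))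

Φ≡false⇔≡0 : ∀ {n m} (p : Tuple n m) k a b → Φ p k a b ≡ false ⇔ p k a b ≡ 0ℚ
Φ≡false⇔≡0 p k a b with p k a b ≟ 0ℚ
... | yes p≡0 = mk⇔ (λ _ → p≡0) (λ _ → refl)
... | no p≢0  = mk⇔ (λ ()) (⊥-elim ∘ p≢0)

Φ≡true⇔≢0 : ∀ {n m} (p : Tuple n m) k a b → Φ p k a b ≡ true ⇔ p k a b ≢ 0ℚ
Φ≡true⇔≢0 p k a b with p k a b ≟ 0ℚ
... | yes p≡0 = mk⇔ (λ ()) (λ p≢0 → ⊥-elim (p≢0 p≡0))
... | no p≢0  = mk⇔ (λ _ → p≢0) (λ _ → refl)

AffineRep-unique : ∀ {m} {A : PSVSet m} {x c c′} → AffinelyIndependent A →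
                   AffineRep A x c → AffineRep A x c′ → ∀ a b → c a b ≡ c′ a b
AffineRep-unique {x = x} {c} {c′} independent (c-supp , c≡1 , x≗c) (c′-supp , c′≡1 , x≗c′) a b =
  difference≡0⇒≡ (independent (c +[ - 1ℚ ] c′) supp total comb≡0 a b)
  where
  supp : SupportedOn _ (c +[ - 1ℚ ] c′)
  supp a b A≡false = cong₂ (λ x y → x + (- 1ℚ) * y) (c-supp a b A≡false) (c′-supp a b A≡false)
  total : ∑₂ (c +[ - 1ℚ ] c′) ≡ 0ℚ
  total = trans (∑₂-+[] c c′ (- 1ℚ)) (cong₂ (λ x y → x + (- 1ℚ) * y) c≡1 c′≡1)
  comb≡0 : ∀ i → comb (c +[ - 1ℚ ] c′) i ≡ 0ℚ
  comb≡0 i = begin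
    comb (c +[ - 1ℚ ] c′) i          ≡⟨ comb-+[] c c′ (- 1ℚ) i ⟩
    comb c i + (- 1ℚ) * comb c′ i    ≡⟨ cong₂ (λ x y → x + (- 1ℚ) * y) (sym (x≗c i)) (sym (x≗c′ i)) ⟩
    x i + (- 1ℚ) * x i               ≡⟨ difference-self (x i) ⟩
    0ℚ                               ∎

marginalPoint : ∀ {n m} {q : Tuple n m} → InDist q → Vec2 m
marginalPoint (_ , _ , v , _) = stack v v

InDist⇒AffineRep : ∀ {n m} {q : Tuple n m} {A k} (q∈ : InDist q) → SupportedOn A (q k) →
                   AffineRep A (marginalPoint q∈) (q k)
InDist⇒AffineRep {q = q} {k = k} (_ , q≡1 , v , qv) supp =
  supp , q≡1 k , from (stack≗comb⇔HasMarginal (q k) v) (qv k)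

InDist⇒InIntersection : ∀ {n m} {q : Tuple n m} {A : Collection n m} → Fin n → (q∈ : InDist q) →
                        (∀ k → SupportedOn (A k) (q k)) → InIntersection A (marginalPoint q∈)
InDist⇒InIntersection {q = q} k₀ q∈@(q≥0 , q≡1 , v , qv) supp = inConv , v , ∑v≡1 , λ _ → refl
  where
  inConv : ∀ k → InConv _ (marginalPoint q∈)
  inConv k = let (_ , _ , x≗q) = InDist⇒AffineRep q∈ (supp k) in q k , supp k , q≥0 k , q≡1 k , x≗q
  ∑v≡1 : ∑ v ≡ 1ℚ
  ∑v≡1 = trans (sym (∑-cong (proj₁ ∘ qv k₀))) (q≡1 k₀)

convexReps : ∀ {n m} {A : Collection n m} {x} → InIntersection A x → Tuple n m
convexReps (inConv , _) k = proj₁ (inConv k)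

convexReps-AffineRep : ∀ {n m} {A : Collection n m} {x} (x∈ : InIntersection A x) k →
                       AffineRep (A k) x (convexReps x∈ k)
convexReps-AffineRep (inConv , _) k =
  let (_ , supp , _ , total , x≗c) = inConv k in supp , total , x≗c

InIntersection⇒InDist : ∀ {n m} {A : Collection n m} {x} (x∈ : InIntersection A x) → InDist (convexReps x∈)
InIntersection⇒InDist x∈@(inConv , α , _ , x≗α) = q≥0 , q≡1 , α , qα
  where
  q : Tuple _ _
  q = convexReps x∈
  q≥0 : ∀ k a b → 0ℚ ℚ.≤ q k a b
  q≥0 k = let (_ , _ , c≥0 , _) = inConv k in c≥0
  q≡1 : ∀ k → ∑₂ (q k) ≡ 1ℚ
  q≡1 k = let (_ , c≡1 , _) = convexReps-AffineRep x∈ k in c≡1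
  qα : ∀ k → HasMarginal (q k) α
  qα k = let (_ , _ , x≗c) = convexReps-AffineRep x∈ k
         in to (stack≗comb⇔HasMarginal (q k) α) (λ i → trans (sym (x≗α i)) (x≗c i))

single : ∀ {n m} → Fin n → Mat m → Tuple n m
single k c k′ with k′ Fin.≟ k
... | yes _ = c
... | no _  = λ _ _ → 0ℚ

single-elim : ∀ {n m} (P : Fin n → Mat m → Set) {k c} → P k c → (∀ k′ → P k′ (λ _ _ → 0ℚ)) →
              ∀ k′ → P k′ (single k c k′)
single-elim P {k} Pkc P0 k′ with k′ Fin.≟ k
... | yes refl = Pkc
... | no _     = P0 k′

single-self : ∀ {n m} (k : Fin n) (c : Mat m) a b → single k c k a b ≡ c a b
single-self k c a b with k Fin.≟ k
... | yes _  = refl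
... | no k≢k = ⊥-elim (k≢k refl)

-- An affine dependence among the vertices of Φ p k, placed on loop k, is a direction supported by p.
IsVertex⇒AffinelyIndependent : ∀ {n m} {p : Tuple n m} → IsVertex p → ∀ k → AffinelyIndependent (Φ p k)
IsVertex⇒AffinelyIndependent {m = m} {p} vertex k c supp c≡0 comb≡0 a b =
  trans (sym (single-self k c a b)) (IsVertex⇒direction≐0 vertex direction single⊆p k a b)
  where
  c-marginal : HasMarginal c (λ _ → 0ℚ)
  c-marginal = to (stack≗comb⇔HasMarginal c _) (λ i → trans (stack-const {m} 0ℚ i) (sym (comb≡0 i)))
  direction : IsDirection (single k c)
  direction = single-elim (λ _ c → ∑₂ {m} c ≡ 0ℚ) c≡0 (λ _ → ∑₂-0 {m})
            , _ , single-elim (λ _ c → HasMarginal c (λ _ → 0ℚ)) c-marginal (λ _ _ → ∑-0 {m} , ∑-0 {m})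
  single⊆p : single k c ⊆ₛ p
  single⊆p = single-elim (λ k c → ∀ a b → p k a b ≡ 0ℚ → c a b ≡ 0ℚ)
                         (λ a b → supp a b ∘ from (Φ≡false⇔≡0 p k a b)) (λ _ _ _ _ → refl)

IsVertex⇒Good : ∀ {n m} {p : Tuple n m} → Fin n → IsVertex p → Good (Φ p)
IsVertex⇒Good {p = p} k₀ vertex@(p∈ , _) = independent , marginalPoint p∈ , x∈ , unique , coefficients≢0
  where
  independent : ∀ k → AffinelyIndependent (Φ p k)
  independent = IsVertex⇒AffinelyIndependent vertex
  p-supp : ∀ k → SupportedOn (Φ p k) (p k)
  p-supp k a b = to (Φ≡false⇔≡0 p k a b)
  x∈ : InIntersection (Φ p) (marginalPoint p∈)
  x∈ = InDist⇒InIntersection k₀ p∈ p-supp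
  p-rep : ∀ k → AffineRep (Φ p k) (marginalPoint p∈) (p k)
  p-rep k = InDist⇒AffineRep p∈ (p-supp k)
  unique : ∀ y → InIntersection (Φ p) y → ∀ i → y i ≡ marginalPoint p∈ i
  unique y y∈ i =
    let (_ , _ , y≗q) = convexReps-AffineRep y∈ k₀
        (_ , _ , x≗p) = p-rep k₀
    in begin
      y i                        ≡⟨ y≗q i ⟩
      comb (convexReps y∈ k₀) i  ≡⟨ ∑₂-cong (λ a b → cong (_* psv a b i) (q≐p k₀ a b)) ⟩
      comb (p k₀) i              ≡⟨ sym (x≗p i) ⟩
      marginalPoint p∈ i         ∎
    where
    q≐p : convexReps y∈ ≐ p
    q≐p = IsVertex⇒SupportRigid vertex (convexReps y∈) (InIntersection⇒InDist y∈)
            (λ k a b p≡0 → proj₁ (convexReps-AffineRep y∈ k) a b (from (Φ≡false⇔≡0 p k a b) p≡0))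
  coefficients≢0 : ∀ k c → AffineRep (Φ p k) (marginalPoint p∈) c → ∀ a b → Φ p k a b ≡ true → c a b ≢ 0ℚ
  coefficients≢0 k c c-rep a b Φ≡true c≡0 =
    to (Φ≡true⇔≢0 p k a b) Φ≡true (trans (sym (AffineRep-unique (independent k) c-rep (p-rep k) a b)) c≡0)

IsVertex-Φ-injective : ∀ {n m} {p q : Tuple n m} → IsVertex p → IsVertex q → Φ p ≗C Φ q → p ≐ q
IsVertex-Φ-injective {p = p} {q} p-vertex (q∈ , _) Φp≗Φq k a b =
  sym (IsVertex⇒SupportRigid p-vertex q q∈ q⊆p k a b)
  where
  q⊆p : q ⊆ₛ p
  q⊆p k a b = to (Φ≡false⇔≡0 q k a b) ∘ trans (sym (Φp≗Φq k a b)) ∘ from (Φ≡false⇔≡0 p k a b)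

Good⇒∃IsVertex : ∀ {n m} {A : Collection n m} → Fin n → Good A → ∃[ p ] (IsVertex p × Φ p ≗C A)
Good⇒∃IsVertex {A = A} k₀ (independent , x , x∈ , unique , coefficients≢0) =
  p , SupportRigid⇒IsVertex (InIntersection⇒InDist x∈) rigid , Φp≗A
  where
  p : Tuple _ _
  p = convexReps x∈
  p-rep : ∀ k → AffineRep (A k) x (p k)
  p-rep = convexReps-AffineRep x∈
  rigid : SupportRigid p
  rigid q q∈ q⊆p k a b = AffineRep-unique (independent k) q-rep (p-rep k) a b
    where
    q-supp : ∀ k → SupportedOn (A k) (q k)
    q-supp k a b = q⊆p k a b ∘ proj₁ (p-rep k) a b
    q-rep : AffineRep (A k) x (q k)
    q-rep = let (supp , total , y≗q) = InDist⇒AffineRep q∈ (q-supp k)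
            in supp , total , λ i → trans (sym (unique _ (InDist⇒InIntersection k₀ q∈ q-supp) i)) (y≗q i)
  Φp≗A : Φ p ≗C A
  Φp≗A k a b with A k a b in A≡
  ... | false = from (Φ≡false⇔≡0 p k a b) (proj₁ (p-rep k) a b A≡)
  ... | true  = from (Φ≡true⇔≢0 p k a b) (coefficients≢0 k (p k) (p-rep k) a b A≡)

corollary4p28 : (n m : ℕ) → 1 ≤ n → 2 ≤ m →
    (∀ (p : Tuple n m) → IsVertex p → Good (Φ p))
    × (∀ (p q : Tuple n m) → IsVertex p → IsVertex q → Φ p ≗C Φ q → p ≐ q)
    × (∀ (A : Collection n m) → Good A → ∃[ p ] (IsVertex p × Φ p ≗C A))
corollary4p28 n m 1≤n _ =
  (λ _ → IsVertex⇒Good k₀) , (λ _ _ → IsVertex-Φ-injective) , (λ _ → Good⇒∃IsVertex k₀)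
  where
  k₀ : Fin n
  k₀ = Fin.fromℕ< 1≤n
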